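{- Let $k$ be odd, $m\ge2$ an integer and $n=2km$. Let $J=J_0\cup J_1\cup J_2\cup J_3\subseteq B_n$, where \begin{align*} J_0&=\{(i;2jm+i-1): 1\le i\le m,\ 0\le j\le k-1\},\\ J_1&=\{(i;2jm+i): m\le i\le 2m-1,\ 0\le j\le k-1\},\\ J_2&=\{(2m(2\ell-1)+i;2jm+i): 0\le i\le 2m-1,\ 0\le j\le k-1,\ 1\le \ell\le (k-1)/2\},\\ J_3&=\{(4m\ell+i;2jm+i+1): 0\le i\le 2m-1,\ 0\le j\le k-1,\ 1\le \ell\le (k-1)/2\}. \end{align*} Then each column of $B_n$ contains exactly $k$ elements of $J$, each symbol in $N_n$ appears in exactly $k$ elements of $J$, and each row of $B_n$ contains exactly $k$ elements of $J$, except row $0$, which contains no elements of $J$, and row $m$, which contains $2k$ elements of $J$.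
   Context: $N_n=\{0,\dots,n-1\}$. $B_n$ is the addition table of the integers mod $n$, viewed as the set of entries (row, column, symbol) $(x,y,x+y \bmod n)$ for $x,y\in N_n$. The notation $(x;y)$ denotes the entry $(x,y,z)$ of $B_n$ with $z\equiv x+y \pmod n$, and all index calculations are reduced mod $n$ to an element of $N_n$. -}

module Defs where

open import Data.Nat using (ℕ; zero; suc; _+_; _*_; _∸_; _≡ᵇ_; _/_)
open import Data.Nat.DivMod using (_%_)
open import Data.Bool using (Bool; _∧_)
open import Data.Bool.ListAction using (any)
open import Data.List using (List; map; upTo; length; filterᵇ; concatMap; _++_)
open import Data.Product using (_×_; _,_; proj₁; proj₂)

-- Reduction mod n to an element of N_n (n is always positive in our use;
-- the zero case is only there to avoid an instance argument).
_mod_ : ℕ → ℕ → ℕ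
a mod zero = a
a mod suc n = a % suc n

range : ℕ → ℕ → List ℕ
range a b = map (a +_) (upTo (suc b ∸ a))

N : ℕ → List ℕ
N n = upTo n

-- Entries of B_n are determined by (row, column); the entry (x;y) is
-- (x mod n, y mod n, (x+y) mod n).  isCell n x y a b : the reduced cell (x;y)
-- is the cell in row a, column b.
isCell : ℕ → ℕ → ℕ → ℕ → ℕ → Bool
isCell n x y a b = (a ≡ᵇ (x mod n)) ∧ (b ≡ᵇ (y mod n))

inJ0 inJ1 inJ2 inJ3 inJ : (k m : ℕ) → ℕ → ℕ → Bool
inJ0 k m a b = any (λ i → any (λ j →
  isCell (2 * k * m) i (2 * j * m + i ∸ 1) a b) (range 0 (k ∸ 1))) (range 1 m)
inJ1 k m a b = any (λ i → any (λ j →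
  isCell (2 * k * m) i (2 * j * m + i) a b) (range 0 (k ∸ 1))) (range m (2 * m ∸ 1))
inJ2 k m a b = any (λ i → any (λ j → any (λ ℓ →
  isCell (2 * k * m) (2 * m * (2 * ℓ ∸ 1) + i) (2 * j * m + i) a b)
    (range 1 ((k ∸ 1) / 2))) (range 0 (k ∸ 1))) (range 0 (2 * m ∸ 1))
inJ3 k m a b = any (λ i → any (λ j → any (λ ℓ →
  isCell (2 * k * m) (4 * m * ℓ + i) (2 * j * m + i + 1) a b)
    (range 1 ((k ∸ 1) / 2))) (range 0 (k ∸ 1))) (range 0 (2 * m ∸ 1))
inJ k m a b = inJ0 k m a b ∨' inJ1 k m a b ∨' inJ2 k m a b ∨' inJ3 k m a b
  where
  open import Data.Bool using () renaming (_∨_ to _∨'_)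

cells : ℕ → List (ℕ × ℕ)
cells n = concatMap (λ a → map (a ,_) (N n)) (N n)

rowCount colCount symCount : (k m : ℕ) → ℕ → ℕ
rowCount k m r = length (filterᵇ (λ b → inJ k m r b) (N (2 * k * m)))
colCount k m c = length (filterᵇ (λ a → inJ k m a c) (N (2 * k * m)))
symCount k m s = length (filterᵇ (λ p → inJ k m (proj₁ p) (proj₂ p) ∧
  (s ≡ᵇ ((proj₁ p + proj₂ p) mod (2 * k * m)))) (cells (2 * k * m)))

module Submission where

-- Put M = 2m, so n = kM, and write each index x < n as x = qM + r with r < M;
-- this cuts B_n into k × k blocks of size M × M.  The key fact is that whether
-- the cell in row qM + r and column jM + c lies in J does not depend on the
-- column block j, and is given by one pattern per row block q:
--   q = 0 (J0 ∪ J1):        r = ρ c, where ρ c = c + 1 for c < m, else ρ c = c;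
--   q = 2ℓ + 1 odd (J2):    c = r;
--   q = 2ℓ + 2 even (J3):   c = r + 1 mod M.  A row sees its pattern row k times.
-- Columns and symbols are summed over the origin row block (contributing 1)
-- and t pairs of an odd and an even row block (contributing 2 each), giving
-- 1 + 2t = k; for symbols one also uses that the k translates x + jM of a
-- column position x hit each symbol congruent to x modulo M exactly once.

open import Data.Bool using (Bool; true; false; _∧_; _∨_; T; if_then_else_)
open import Data.Bool.ListAction using (any; or)
open import Data.Bool.Properties using (∧-identityʳ; ∨-identityʳ)
open import Data.Empty using (⊥; ⊥-elim)
open import Data.List using (List; []; _∷_; map; upTo; applyUpTo; length; filterᵇ; concat; _++_)
open import Data.List.Properties using (map-∘)
open import Data.Nat using (ℕ; zero; suc; pred; s≤s⁻¹; _+_; _*_; _∸_; NonZero; _/_; _≤_; _<_;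
  _≡ᵇ_; _<ᵇ_; s≤s; z≤n)
open import Data.Nat.Divisibility using (divides)
open import Data.Nat.DivMod using (_%_; %-distribˡ-+; m%n%n≡m%n; [m+n]%n≡m%n; m%n<n; n%n≡0;
  m∣n⇒o%n%m≡o%m; m*n/n≡m; m<n*o⇒m/o<n; m<n⇒m%n≡m; [m+kn]%n≡m%n; m≡m%n+[m/n]*n)
open import Data.Nat.Properties
open import Data.Nat.Tactic.RingSolver using (solve-∀)
open import Data.Product using (Σ; _×_; _,_; proj₁; proj₂; ∃-syntax)
open import Data.Sum using (_⊎_; inj₁; inj₂)
open import Data.Unit using (tt)
open import Relation.Binary using (tri<; tri≈; tri>)
open import Relation.Binary.PropositionalEquality
open ≡-Reasoning
open import Relation.Nullary using (yes; no)

open import Defs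

sumN : (ℕ → ℕ) → ℕ → ℕ
sumN f zero = 0
sumN f (suc n) = f 0 + sumN (λ i → f (suc i)) n

sumN-ext : ∀ n (f g : ℕ → ℕ) → (∀ i → i < n → f i ≡ g i) → sumN f n ≡ sumN g n
sumN-ext zero f g f≗g = refl
sumN-ext (suc n) f g f≗g =
  cong₂ _+_ (f≗g 0 (s≤s z≤n)) (sumN-ext n _ _ (λ i i<n → f≗g (suc i) (s≤s i<n)))

sumN-+ : ∀ a b (f : ℕ → ℕ) → sumN f (a + b) ≡ sumN f a + sumN (λ i → f (a + i)) b
sumN-+ zero b f = refl
sumN-+ (suc a) b f =
  trans (cong (f 0 +_) (sumN-+ a b (λ i → f (suc i)))) (sym (+-assoc (f 0) _ _))

sumN-distrib : ∀ n (f g : ℕ → ℕ) → sumN (λ i → f i + g i) n ≡ sumN f n + sumN g n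
sumN-distrib zero f g = refl
sumN-distrib (suc n) f g =
  trans (cong (f 0 + g 0 +_) (sumN-distrib n (λ i → f (suc i)) (λ i → g (suc i))))
        (interchange (f 0) (g 0) _ _)
  where
  interchange : ∀ a b c d → a + b + (c + d) ≡ a + c + (b + d)
  interchange = solve-∀

sumN-const : ∀ n x → sumN (λ _ → x) n ≡ n * x
sumN-const zero x = refl
sumN-const (suc n) x = cong (x +_) (sumN-const n x)

sumN-zero : ∀ n (f : ℕ → ℕ) → (∀ i → i < n → f i ≡ 0) → sumN f n ≡ 0
sumN-zero n f f≗0 = trans (sumN-ext n f (λ _ → 0) f≗0) (trans (sumN-const n 0) (*-zeroʳ n))

sumN-single : ∀ n q (f : ℕ → ℕ) → q < n → (∀ i → i < n → i ≢ q → f i ≡ 0) →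
  sumN f n ≡ f q
sumN-single (suc n) zero f q<n f≗0 =
  trans (cong (f 0 +_) (sumN-zero n _ (λ i i<n → f≗0 (suc i) (s≤s i<n) (λ ()))))
        (+-identityʳ _)
sumN-single (suc n) (suc q) f (s≤s q<n) f≗0 =
  trans (cong (_+ sumN (λ i → f (suc i)) n) (f≗0 0 (s≤s z≤n) (λ ())))
        (sumN-single n q _ q<n
          (λ i i<n i≢q → f≗0 (suc i) (s≤s i<n) (λ e → i≢q (suc-injective e))))

sumN-last : ∀ n (f : ℕ → ℕ) → sumN f (suc n) ≡ sumN f n + f n
sumN-last n f = begin
  sumN f (suc n)                               ≡⟨ cong (sumN f) (+-comm 1 n) ⟩
  sumN f (n + 1)                               ≡⟨ sumN-+ n 1 f ⟩
  sumN f n + (f (n + 0) + 0)                   ≡⟨ cong (λ x → sumN f n + x) (+-identityʳ _) ⟩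
  sumN f n + f (n + 0)                         ≡⟨ cong (λ x → sumN f n + f x) (+-identityʳ n) ⟩
  sumN f n + f n                               ∎

sumN-rotate : ∀ n (f : ℕ → ℕ) → f n ≡ f 0 → sumN (λ i → f (suc i)) n ≡ sumN f n
sumN-rotate zero f periodic = refl
sumN-rotate (suc n) f periodic =
  trans (sumN-last n (λ i → f (suc i)))
        (trans (cong (sumN (λ i → f (suc i)) n +_) periodic) (+-comm _ (f 0)))

sumN-blocks : ∀ J M (f : ℕ → ℕ) →
  sumN f (J * M) ≡ sumN (λ j → sumN (λ c → f (j * M + c)) M) J
sumN-blocks zero M f = refl
sumN-blocks (suc J) M f =
  trans (sumN-+ M (J * M) f)
    (cong (sumN f M +_) (trans (sumN-blocks J M (λ i → f (M + i)))
      (sumN-ext J _ _ (λ j _ → sumN-ext M _ _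
        (λ c _ → cong f (sym (+-assoc M (j * M) c)))))))

sumN-swap : ∀ J M (g : ℕ → ℕ → ℕ) →
  sumN (λ j → sumN (g j) M) J ≡ sumN (λ c → sumN (λ j → g j c) J) M
sumN-swap zero M g = sym (sumN-zero M _ (λ _ _ → refl))
sumN-swap (suc J) M g =
  trans (cong (sumN (g 0) M +_) (sumN-swap J M (λ j → g (suc j))))
        (sym (sumN-distrib M (g 0) (λ c → sumN (λ j → g (suc j) c) J)))

sumN-pairs : ∀ N (f : ℕ → ℕ) → sumN f (N + N) ≡ sumN (λ i → f (i + i) + f (suc (i + i))) N
sumN-pairs zero f = refl
sumN-pairs (suc N) f = begin
  f 0 + sumN (λ i → f (suc i)) (N + suc N)
    ≡⟨ cong (λ x → f 0 + sumN (λ i → f (suc i)) x) (+-suc N N) ⟩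
  f 0 + (f 1 + sumN (λ i → f (suc (suc i))) (N + N))
    ≡⟨ sym (+-assoc (f 0) (f 1) _) ⟩
  f 0 + f 1 + sumN (λ i → f (suc (suc i))) (N + N)
    ≡⟨ cong (f 0 + f 1 +_) (sumN-pairs N (λ i → f (suc (suc i)))) ⟩
  f 0 + f 1 + sumN (λ i → f (suc (suc (i + i))) + f (suc (suc (suc (i + i))))) N
    ≡⟨ cong (f 0 + f 1 +_) (sumN-ext N _ _ (λ i _ → cong₂ _+_
         (cong f (sym (+-suc (suc i) i))) (cong (λ x → f (suc x)) (sym (+-suc (suc i) i))))) ⟩
  f 0 + f 1 + sumN (λ i → f (suc i + suc i) + f (suc (suc i + suc i))) N ∎

χ : Bool → ℕ
χ true = 1
χ false = 0

¬true⇒false : ∀ b → (b ≡ true → ⊥) → b ≡ false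
¬true⇒false false _ = refl
¬true⇒false true ¬b = ⊥-elim (¬b refl)

bool-ext : ∀ x y → (x ≡ true → y ≡ true) → (y ≡ true → x ≡ true) → x ≡ y
bool-ext true true _ _ = refl
bool-ext false false _ _ = refl
bool-ext true false x⇒y _ = sym (x⇒y refl)
bool-ext false true _ y⇒x = y⇒x refl

∧-true⁻ : ∀ x y → x ∧ y ≡ true → x ≡ true × y ≡ true
∧-true⁻ true true _ = refl , refl

∨-true⁻ : ∀ x y → x ∨ y ≡ true → x ≡ true ⊎ y ≡ true
∨-true⁻ true y _ = inj₁ refl
∨-true⁻ false y y≡true = inj₂ y≡true

∨-trueˡ : ∀ {x} y → x ≡ true → x ∨ y ≡ true
∨-trueˡ _ refl = refl

∨-trueʳ : ∀ x {y} → y ≡ true → x ∨ y ≡ true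
∨-trueʳ true _ = refl
∨-trueʳ false y≡true = y≡true

T⇒≡true : ∀ {b} → T b → b ≡ true
T⇒≡true {true} _ = refl

≡true⇒T : ∀ {b} → b ≡ true → T b
≡true⇒T refl = tt

≡ᵇ-sound : ∀ a b → (a ≡ᵇ b) ≡ true → a ≡ b
≡ᵇ-sound a b e = ≡ᵇ⇒≡ a b (≡true⇒T e)

≡ᵇ-refl : ∀ a → (a ≡ᵇ a) ≡ true
≡ᵇ-refl a = T⇒≡true (≡⇒≡ᵇ a a refl)

≡ᵇ-complete : ∀ {a b} → a ≡ b → (a ≡ᵇ b) ≡ true
≡ᵇ-complete {a} refl = ≡ᵇ-refl a

≡ᵇ-false : ∀ a b → a ≢ b → (a ≡ᵇ b) ≡ false
≡ᵇ-false a b a≢b = ¬true⇒false (a ≡ᵇ b) (λ e → a≢b (≡ᵇ-sound a b e))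

≡ᵇ-comm : ∀ a b → (a ≡ᵇ b) ≡ (b ≡ᵇ a)
≡ᵇ-comm zero zero = refl
≡ᵇ-comm zero (suc b) = refl
≡ᵇ-comm (suc a) zero = refl
≡ᵇ-comm (suc a) (suc b) = ≡ᵇ-comm a b

sum-δ : ∀ N x (P : ℕ → Bool) → x < N → sumN (λ c → χ ((c ≡ᵇ x) ∧ P c)) N ≡ χ (P x)
sum-δ N x P x<N =
  trans (sumN-single N x _ x<N (λ i _ i≢x → cong (λ b → χ (b ∧ P i)) (≡ᵇ-false i x i≢x)))
        (cong (λ b → χ (b ∧ P x)) (≡ᵇ-refl x))

sum-δ₁ : ∀ N x → x < N → sumN (λ c → χ (c ≡ᵇ x)) N ≡ 1
sum-δ₁ N x x<N =
  trans (sumN-ext N _ _ (λ c _ → cong χ (sym (∧-identityʳ (c ≡ᵇ x))))) (sum-δ N x (λ _ → true) x<N)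

sum-χ-∧ : ∀ N (B : Bool) (h : ℕ → Bool) v → sumN (λ j → χ (h j)) N ≡ χ v →
  sumN (λ j → χ (B ∧ h j)) N ≡ χ (B ∧ v)
sum-χ-∧ N true h v count = count
sum-χ-∧ N false h v _ = sumN-zero N (λ _ → 0) (λ _ _ → refl)

length-filter-applyUpTo : ∀ (p : ℕ → Bool) h n →
  length (filterᵇ p (applyUpTo h n)) ≡ sumN (λ i → χ (p (h i))) n
length-filter-applyUpTo p h zero = refl
length-filter-applyUpTo p h (suc n) with p (h 0)
... | true = cong suc (length-filter-applyUpTo p (λ i → h (suc i)) n)
... | false = length-filter-applyUpTo p (λ i → h (suc i)) n

module _ {A : Set} (p : A → Bool) where
  length-filter-++ : ∀ xs ys →
    length (filterᵇ p (xs ++ ys)) ≡ length (filterᵇ p xs) + length (filterᵇ p ys)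
  length-filter-++ [] ys = refl
  length-filter-++ (x ∷ xs) ys with p x
  ... | true = cong suc (length-filter-++ xs ys)
  ... | false = length-filter-++ xs ys

  length-filter-concat : ∀ (g : ℕ → List A) (h : ℕ → ℕ) N →
    length (filterᵇ p (concat (map g (applyUpTo h N)))) ≡
    sumN (λ a → length (filterᵇ p (g (h a)))) N
  length-filter-concat g h zero = refl
  length-filter-concat g h (suc N) =
    trans (length-filter-++ (g (h 0)) _)
          (cong (length (filterᵇ p (g (h 0))) +_) (length-filter-concat g (λ i → h (suc i)) N))

length-filter-pairs : ∀ {B : Set} (p : ℕ × B → Bool) a (ys : List B) →
  length (filterᵇ p (map (a ,_) ys)) ≡ length (filterᵇ (λ b → p (a , b)) ys)
length-filter-pairs p a [] = refl
length-filter-pairs p a (y ∷ ys) with p (a , y)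
... | true = cong suc (length-filter-pairs p a ys)
... | false = length-filter-pairs p a ys

any-applyUpTo⁻ : ∀ (p : ℕ → Bool) (h : ℕ → ℕ) n → any p (applyUpTo h n) ≡ true →
  Σ ℕ λ i → i < n × p (h i) ≡ true
any-applyUpTo⁻ p h (suc n) found with p (h 0) in here
... | true = 0 , s≤s z≤n , here
... | false with any-applyUpTo⁻ p (λ i → h (suc i)) n found
...   | i , i<n , pass = suc i , s≤s i<n , pass

any-applyUpTo⁺ : ∀ (p : ℕ → Bool) (h : ℕ → ℕ) n i → i < n → p (h i) ≡ true →
  any p (applyUpTo h n) ≡ true
any-applyUpTo⁺ p h (suc n) zero _ pass = ∨-trueˡ _ pass
any-applyUpTo⁺ p h (suc n) (suc i) (s≤s i<n) pass =
  ∨-trueʳ (p (h 0)) (any-applyUpTo⁺ p (λ i → h (suc i)) n i i<n pass)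

any-range⁻ : ∀ (p : ℕ → Bool) a b → any p (range a b) ≡ true →
  Σ ℕ λ i → i < suc b ∸ a × p (a + i) ≡ true
any-range⁻ p a b found =
  any-applyUpTo⁻ (λ x → p (a + x)) (λ x → x) (suc b ∸ a)
    (trans (cong or (map-∘ (upTo (suc b ∸ a)))) found)

any-range⁺ : ∀ (p : ℕ → Bool) a b i → i < suc b ∸ a → p (a + i) ≡ true →
  any p (range a b) ≡ true
any-range⁺ p a b i i<len pass =
  trans (cong or (sym (map-∘ (upTo (suc b ∸ a)))))
        (any-applyUpTo⁺ (λ x → p (a + x)) (λ x → x) (suc b ∸ a) i i<len pass)

sumN-origin-pairs : ∀ t M (f : ℕ → ℕ) →
  sumN f (M + t * (M + M)) ≡
  sumN f M + sumN (λ ℓ → sumN (λ r → f (suc (2 * ℓ) * M + r)) M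
                       + sumN (λ r → f (suc (suc (2 * ℓ)) * M + r)) M) t
sumN-origin-pairs t M f =
  trans (sumN-+ M (t * (M + M)) f) (cong (sumN f M +_)
    (trans (sumN-blocks t (M + M) (λ i → f (M + i)))
      (sumN-ext t _ _ (λ ℓ _ → trans (sumN-+ M M _) (cong₂ _+_
        (sumN-ext M _ _ (λ r _ → cong f (odd-block M ℓ r)))
        (sumN-ext M _ _ (λ r _ → cong f (even-block M ℓ r))))))))
  where
  odd-block : ∀ M ℓ r → M + (ℓ * (M + M) + r) ≡ suc (2 * ℓ) * M + r
  odd-block = solve-∀
  even-block : ∀ M ℓ r → M + (ℓ * (M + M) + (M + r)) ≡ suc (suc (2 * ℓ)) * M + r
  even-block = solve-∀

window-hit : ∀ a N r → a ≤ r → r < a + N → sumN (λ c → χ (r ≡ᵇ a + c)) N ≡ 1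
window-hit a N r a≤r r<a+N =
  trans (sumN-single N (r ∸ a) _ (+-cancelˡ-< a (r ∸ a) N (subst (_< a + N) (sym a+[r∸a]≡r) r<a+N))
          (λ c _ c≢r∸a → cong χ (≡ᵇ-false r (a + c)
            (λ r≡a+c → c≢r∸a (sym (trans (cong (_∸ a) r≡a+c) (m+n∸m≡n a c)))))))
        (cong χ (trans (cong (r ≡ᵇ_) a+[r∸a]≡r) (≡ᵇ-refl r)))
  where
  a+[r∸a]≡r : a + (r ∸ a) ≡ r
  a+[r∸a]≡r = m+[n∸m]≡n a≤r

window-miss : ∀ a N r → r < a ⊎ a + N ≤ r → sumN (λ c → χ (r ≡ᵇ a + c)) N ≡ 0
window-miss a N r outside = sumN-zero N _ (λ c c<N → cong χ (≡ᵇ-false r (a + c) (r≢a+c c c<N outside)))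
  where
  r≢a+c : ∀ c → c < N → r < a ⊎ a + N ≤ r → r ≢ a + c
  r≢a+c c _ (inj₁ r<a) refl = m+n≮m a c r<a
  r≢a+c c c<N (inj₂ a+N≤r) refl = <⇒≱ (+-monoʳ-< a c<N) a+N≤r

block-bound : ∀ M K j c → j < K → c < M → j * M + c < K * M
block-bound M K j c j<K c<M =
  ≤-trans (+-monoʳ-< (j * M) c<M) (≤-trans (≤-reflexive (+-comm (j * M) M)) (*-monoˡ-≤ M j<K))

block-offset-mod : ∀ M .{{_ : NonZero M}} q x → (q * M + x) % M ≡ x % M
block-offset-mod M q x = trans (cong (_% M) (+-comm (q * M) x)) ([m+kn]%n≡m%n x q M)

block-coords-injective : ∀ M .{{_ : NonZero M}} q r q' r' → q * M + r ≡ q' * M + r' →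
  r < M → r' < M → q ≡ q' × r ≡ r'
block-coords-injective M q r q' r' same r<M r'<M = q≡q' , r≡r'
  where
  remainder : ∀ q r → r < M → (q * M + r) % M ≡ r
  remainder q r r<M = trans (block-offset-mod M q r) (m<n⇒m%n≡m r<M)
  r≡r' : r ≡ r'
  r≡r' = trans (sym (remainder q r r<M)) (trans (cong (_% M) same) (remainder q' r' r'<M))
  q≡q' : q ≡ q'
  q≡q' = *-cancelʳ-≡ q q' M (+-cancelʳ-≡ _ _ _ (trans same (cong (q' * M +_) (sym r≡r'))))

block-coords : ∀ M .{{_ : NonZero M}} x → x ≡ x / M * M + x % M
block-coords M x = trans (m≡m%n+[m/n]*n x M) (+-comm (x % M) _)

parity : ∀ q → (Σ ℕ λ h → q ≡ 2 * h) ⊎ (Σ ℕ λ h → q ≡ suc (2 * h))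
parity zero = inj₁ (0 , refl)
parity (suc q) with parity q
... | inj₁ (h , q≡2h) = inj₂ (h , cong suc q≡2h)
... | inj₂ (h , q≡2h+1) = inj₁ (suc h , trans (cong suc q≡2h+1) (sym (*-suc 2 h)))

mod-summand : ∀ M .{{_ : NonZero M}} x y → (x + y % M) % M ≡ (x + y) % M
mod-summand M x y =
  trans (%-distribˡ-+ x (y % M) M)
        (trans (cong (λ z → (x % M + z) % M) (m%n%n≡m%n y M)) (sym (%-distribˡ-+ x y M)))

module Layout (t m' : ℕ) where
  k m M n : ℕ
  k = suc (2 * t)
  m = suc (suc m')
  M = 2 * m
  n = 2 * k * m

  n≡k*M : n ≡ k * M
  n≡k*M = reassociate k m
    where
    reassociate : ∀ k m → 2 * k * m ≡ k * (2 * m)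
    reassociate = solve-∀

  2jm≡jM : ∀ j → 2 * j * m ≡ j * M
  2jm≡jM j = reassociate j m
    where
    reassociate : ∀ j m → 2 * j * m ≡ j * (2 * m)
    reassociate = solve-∀

  M≡m+m : M ≡ m + m
  M≡m+m = cong (m +_) (+-identityʳ m)

  0<m : 0 < m
  0<m = s≤s z≤n

  m<M : m < M
  m<M = subst (m <_) (sym M≡m+m) (m<m+n m (s≤s z≤n))

  m+i<M : ∀ {i} → i < m → m + i < M
  m+i<M {i} i<m = subst (m + i <_) (sym M≡m+m) (+-monoʳ-< m i<m)

  in-range : ∀ {j c} → j < k → c < M → j * M + c < n
  in-range {j} {c} j<k c<M = subst (j * M + c <_) (sym n≡k*M) (block-bound M k j c j<k c<M)

  in-origin-block : ∀ {x} → x < M → x < n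
  in-origin-block = in-range (s≤s z≤n)

  mod-n : ∀ {x} → x < n → x mod n ≡ x
  mod-n = m<n⇒m%n≡m

  block<k : ∀ {x} → x < n → x / M < k
  block<k {x} x<n = m<n*o⇒m/o<n (subst (x <_) n≡k*M x<n)

  odd≢even : ∀ a b → suc (2 * a) ≢ suc (suc (2 * b))
  odd≢even a b e = even≢odd (suc b) a (trans (*-suc 2 b) (sym e))

  -- The index bounds of J2 and J3: 1 ≤ ℓ ≤ (k - 1)/2 means ℓ = ℓ' + 1 with ℓ' < t.
  ℓ-range : suc ((k ∸ 1) / 2) ∸ 1 ≡ t
  ℓ-range = trans (cong (_/ 2) (*-comm 2 t)) (m*n/n≡m t 2)

  odd-block<k : ∀ {ℓ} → ℓ < t → suc (2 * ℓ) < k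
  odd-block<k ℓ<t = s≤s (*-monoʳ-< 2 ℓ<t)

  even-block<k : ∀ {ℓ} → ℓ < t → suc (suc (2 * ℓ)) < k
  even-block<k {ℓ} ℓ<t = s≤s (subst (_≤ 2 * t) (*-suc 2 ℓ) (*-monoʳ-≤ 2 ℓ<t))

  cell⁻ : ∀ x y a b → isCell n x y a b ≡ true → a ≡ x mod n × b ≡ y mod n
  cell⁻ x y a b e with ∧-true⁻ _ _ e
  ... | a-test , b-test = ≡ᵇ-sound _ _ a-test , ≡ᵇ-sound _ _ b-test

  cell⁺ : ∀ x y a b → a ≡ x mod n → b ≡ y mod n → isCell n x y a b ≡ true
  cell⁺ x y a b refl refl = cong₂ _∧_ (≡ᵇ-refl (x mod n)) (≡ᵇ-refl (y mod n))

  J0-cell : ℕ → ℕ → ℕ → ℕ → Bool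
  J0-cell a b i j = isCell n i (2 * j * m + i ∸ 1) a b

  J0-column : ∀ j i → 2 * j * m + suc i ∸ 1 ≡ j * M + i
  J0-column j i = trans (cong (_∸ 1) (+-suc (2 * j * m) i)) (cong (_+ i) (2jm≡jM j))

  J0⁻ : ∀ a b → inJ0 k m a b ≡ true →
    Σ ℕ λ i → Σ ℕ λ j → i < m × j < k × a ≡ suc i × b ≡ j * M + i
  J0⁻ a b e with any-range⁻ (λ i → any (J0-cell a b i) (range 0 (k ∸ 1))) 1 m e
  ... | i , i<m , e′ with any-range⁻ (J0-cell a b (suc i)) 0 (k ∸ 1) e′
  ... | j , j<k , e″ with cell⁻ (suc i) (2 * j * m + suc i ∸ 1) a b e″
  ... | a≡ , b≡ = i , j , i<m , j<k ,
    trans a≡ (mod-n (in-origin-block (≤-<-trans i<m m<M))) ,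
    trans b≡ (trans (cong (_mod n) (J0-column j i)) (mod-n (in-range j<k (<-trans i<m m<M))))

  J0⁺ : ∀ i j → i < m → j < k → inJ0 k m (suc i) (j * M + i) ≡ true
  J0⁺ i j i<m j<k =
    any-range⁺ (λ i′ → any (J0-cell a b i′) (range 0 (k ∸ 1))) 1 m i i<m
      (any-range⁺ (J0-cell a b (suc i)) 0 (k ∸ 1) j j<k
        (cell⁺ (suc i) (2 * j * m + suc i ∸ 1) a b
          (sym (mod-n (in-origin-block (≤-<-trans i<m m<M))))
          (sym (trans (cong (_mod n) (J0-column j i)) (mod-n (in-range j<k (<-trans i<m m<M)))))))
    where
    a = suc i
    b = j * M + i

  J1-cell : ℕ → ℕ → ℕ → ℕ → Bool
  J1-cell a b i j = isCell n i (2 * j * m + i) a b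

  J1-range : suc (2 * m ∸ 1) ∸ m ≡ m
  J1-range = trans (m+n∸m≡n m (1 * m)) (*-identityˡ m)

  J1⁻ : ∀ a b → inJ1 k m a b ≡ true →
    Σ ℕ λ i → Σ ℕ λ j → i < m × j < k × a ≡ m + i × b ≡ j * M + (m + i)
  J1⁻ a b e with any-range⁻ (λ i → any (J1-cell a b i) (range 0 (k ∸ 1))) m (2 * m ∸ 1) e
  ... | i , i<range , e′ with any-range⁻ (J1-cell a b (m + i)) 0 (k ∸ 1) e′
  ... | j , j<k , e″ with cell⁻ (m + i) (2 * j * m + (m + i)) a b e″
  ... | a≡ , b≡ = i , j , i<m , j<k ,
    trans a≡ (mod-n (in-origin-block (m+i<M i<m))) ,
    trans b≡ (trans (cong (λ x → (x + (m + i)) mod n) (2jm≡jM j)) (mod-n (in-range j<k (m+i<M i<m))))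
    where
    i<m : i < m
    i<m = subst (i <_) J1-range i<range

  J1⁺ : ∀ i j → i < m → j < k → inJ1 k m (m + i) (j * M + (m + i)) ≡ true
  J1⁺ i j i<m j<k =
    any-range⁺ (λ i′ → any (J1-cell a b i′) (range 0 (k ∸ 1))) m (2 * m ∸ 1) i
      (subst (i <_) (sym J1-range) i<m)
      (any-range⁺ (J1-cell a b (m + i)) 0 (k ∸ 1) j j<k
        (cell⁺ (m + i) (2 * j * m + (m + i)) a b
          (sym (mod-n (in-origin-block (m+i<M i<m))))
          (sym (trans (cong (λ x → (x + (m + i)) mod n) (2jm≡jM j)) (mod-n (in-range j<k (m+i<M i<m)))))))
    where
    a = m + i
    b = j * M + (m + i)

  J2-cell : ℕ → ℕ → ℕ → ℕ → ℕ → Bool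
  J2-cell a b i j ℓ = isCell n (2 * m * (2 * ℓ ∸ 1) + i) (2 * j * m + i) a b

  J2-row : ∀ ℓ i → 2 * m * (2 * suc ℓ ∸ 1) + i ≡ suc (2 * ℓ) * M + i
  J2-row ℓ i = trans (cong (λ x → 2 * m * (x ∸ 1) + i) (*-suc 2 ℓ)) (reassociate m ℓ i)
    where
    reassociate : ∀ m ℓ i → 2 * m * suc (2 * ℓ) + i ≡ suc (2 * ℓ) * (2 * m) + i
    reassociate = solve-∀

  J2⁻ : ∀ a b → inJ2 k m a b ≡ true → Σ ℕ λ i → Σ ℕ λ j → Σ ℕ λ ℓ →
    i < M × j < k × ℓ < t × a ≡ suc (2 * ℓ) * M + i × b ≡ j * M + i
  J2⁻ a b e with any-range⁻ (λ i → any (λ j → any (J2-cell a b i j) (range 1 ((k ∸ 1) / 2))) (range 0 (k ∸ 1)))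
    0 (2 * m ∸ 1) e
  ... | i , i<M , e′ with any-range⁻ (λ j → any (J2-cell a b i j) (range 1 ((k ∸ 1) / 2))) 0 (k ∸ 1) e′
  ... | j , j<k , e″ with any-range⁻ (J2-cell a b i j) 1 ((k ∸ 1) / 2) e″
  ... | ℓ , ℓ<range , e‴ with cell⁻ (2 * m * (2 * suc ℓ ∸ 1) + i) (2 * j * m + i) a b e‴
  ... | a≡ , b≡ = i , j , ℓ , i<M , j<k , ℓ<t ,
    trans a≡ (trans (cong (_mod n) (J2-row ℓ i)) (mod-n (in-range (odd-block<k ℓ<t) i<M))) ,
    trans b≡ (trans (cong (λ x → (x + i) mod n) (2jm≡jM j)) (mod-n (in-range j<k i<M)))
    where
    ℓ<t : ℓ < t
    ℓ<t = subst (ℓ <_) ℓ-range ℓ<range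

  J2⁺ : ∀ i j ℓ → i < M → j < k → ℓ < t → inJ2 k m (suc (2 * ℓ) * M + i) (j * M + i) ≡ true
  J2⁺ i j ℓ i<M j<k ℓ<t =
    any-range⁺ (λ i′ → any (λ j′ → any (J2-cell a b i′ j′) ℓs) (range 0 (k ∸ 1))) 0 (2 * m ∸ 1) i i<M
      (any-range⁺ (λ j′ → any (J2-cell a b i j′) ℓs) 0 (k ∸ 1) j j<k
        (any-range⁺ (J2-cell a b i j) 1 ((k ∸ 1) / 2) ℓ (subst (ℓ <_) (sym ℓ-range) ℓ<t)
          (cell⁺ (2 * m * (2 * suc ℓ ∸ 1) + i) (2 * j * m + i) a b
            (sym (trans (cong (_mod n) (J2-row ℓ i)) (mod-n (in-range (odd-block<k ℓ<t) i<M))))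
            (sym (trans (cong (λ x → (x + i) mod n) (2jm≡jM j)) (mod-n (in-range j<k i<M)))))))
    where
    a = suc (2 * ℓ) * M + i
    b = j * M + i
    ℓs = range 1 ((k ∸ 1) / 2)

  -- J3 = {(4mℓ + i ; 2jm + i + 1)}: row i of the even row block 2ℓ, with column
  -- i + 1 of each column block (wrapping around at the end of N_n).
  J3-cell : ℕ → ℕ → ℕ → ℕ → ℕ → Bool
  J3-cell a b i j ℓ = isCell n (4 * m * ℓ + i) (2 * j * m + i + 1) a b

  J3-row : ∀ ℓ i → 4 * m * suc ℓ + i ≡ suc (suc (2 * ℓ)) * M + i
  J3-row ℓ i = reassociate m ℓ i
    where
    reassociate : ∀ m ℓ i → 4 * m * suc ℓ + i ≡ suc (suc (2 * ℓ)) * (2 * m) + i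
    reassociate = solve-∀

  J3-column : ∀ j i → 2 * j * m + i + 1 ≡ j * M + suc i
  J3-column j i = reassociate j m i
    where
    reassociate : ∀ j m i → 2 * j * m + i + 1 ≡ j * (2 * m) + suc i
    reassociate = solve-∀

  J3⁻ : ∀ a b → inJ3 k m a b ≡ true → Σ ℕ λ i → Σ ℕ λ j → Σ ℕ λ ℓ →
    i < M × j < k × ℓ < t × a ≡ suc (suc (2 * ℓ)) * M + i × b ≡ (j * M + suc i) mod n
  J3⁻ a b e with any-range⁻ (λ i → any (λ j → any (J3-cell a b i j) (range 1 ((k ∸ 1) / 2))) (range 0 (k ∸ 1)))
    0 (2 * m ∸ 1) e
  ... | i , i<M , e′ with any-range⁻ (λ j → any (J3-cell a b i j) (range 1 ((k ∸ 1) / 2))) 0 (k ∸ 1) e′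
  ... | j , j<k , e″ with any-range⁻ (J3-cell a b i j) 1 ((k ∸ 1) / 2) e″
  ... | ℓ , ℓ<range , e‴ with cell⁻ (4 * m * suc ℓ + i) (2 * j * m + i + 1) a b e‴
  ... | a≡ , b≡ = i , j , ℓ , i<M , j<k , ℓ<t ,
    trans a≡ (trans (cong (_mod n) (J3-row ℓ i)) (mod-n (in-range (even-block<k ℓ<t) i<M))) ,
    trans b≡ (cong (_mod n) (J3-column j i))
    where
    ℓ<t : ℓ < t
    ℓ<t = subst (ℓ <_) ℓ-range ℓ<range

  J3⁺ : ∀ i j ℓ → i < M → j < k → ℓ < t →
    inJ3 k m (suc (suc (2 * ℓ)) * M + i) ((j * M + suc i) mod n) ≡ true
  J3⁺ i j ℓ i<M j<k ℓ<t =
    any-range⁺ (λ i′ → any (λ j′ → any (J3-cell a b i′ j′) ℓs) (range 0 (k ∸ 1))) 0 (2 * m ∸ 1) i i<M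
      (any-range⁺ (λ j′ → any (J3-cell a b i j′) ℓs) 0 (k ∸ 1) j j<k
        (any-range⁺ (J3-cell a b i j) 1 ((k ∸ 1) / 2) ℓ (subst (ℓ <_) (sym ℓ-range) ℓ<t)
          (cell⁺ (4 * m * suc ℓ + i) (2 * j * m + i + 1) a b
            (sym (trans (cong (_mod n) (J3-row ℓ i)) (mod-n (in-range (even-block<k ℓ<t) i<M))))
            (sym (cong (_mod n) (J3-column j i))))))
    where
    a = suc (suc (2 * ℓ)) * M + i
    b = (j * M + suc i) mod n
    ℓs = range 1 ((k ∸ 1) / 2)

  J0-origin-only : ∀ q r b → r < M → inJ0 k m (suc q * M + r) b ≡ false
  J0-origin-only q r b r<M = ¬true⇒false _ λ e →
    let (i , _ , i<m , _ , a≡ , _) = J0⁻ _ b e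
    in 1+n≢0 (proj₁ (block-coords-injective M (suc q) r 0 (suc i) a≡ r<M (≤-<-trans i<m m<M)))

  J1-origin-only : ∀ q r b → r < M → inJ1 k m (suc q * M + r) b ≡ false
  J1-origin-only q r b r<M = ¬true⇒false _ λ e →
    let (i , _ , i<m , _ , a≡ , _) = J1⁻ _ b e
    in 1+n≢0 (proj₁ (block-coords-injective M (suc q) r 0 (m + i) a≡ r<M (m+i<M i<m)))

  J2-odd-only : ∀ q r b → r < M → (∀ ℓ → q ≢ suc (2 * ℓ)) → inJ2 k m (q * M + r) b ≡ false
  J2-odd-only q r b r<M not-odd = ¬true⇒false _ λ e →
    let (i , _ , ℓ , i<M , _ , _ , a≡ , _) = J2⁻ _ b e
    in not-odd ℓ (proj₁ (block-coords-injective M q r (suc (2 * ℓ)) i a≡ r<M i<M))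

  J3-even-only : ∀ q r b → r < M → (∀ ℓ → q ≢ suc (suc (2 * ℓ))) → inJ3 k m (q * M + r) b ≡ false
  J3-even-only q r b r<M not-even = ¬true⇒false _ λ e →
    let (i , _ , ℓ , i<M , _ , _ , a≡ , _) = J3⁻ _ b e
    in not-even ℓ (proj₁ (block-coords-injective M q r (suc (suc (2 * ℓ))) i a≡ r<M i<M))

  -- In the origin row block, column c of every column block meets J in exactly
  -- one row ρ c: row c + 1 (an entry of J0) if c < m, row c (of J1) otherwise.
  ρ : ℕ → ℕ
  ρ c = if c <ᵇ m then suc c else c

  ρ-low : ∀ {c} → c < m → ρ c ≡ suc c
  ρ-low {c} c<m = cong (λ b → if b then suc c else c) (T⇒≡true (<⇒<ᵇ c<m))

  ρ-high : ∀ {c} → m ≤ c → ρ c ≡ c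
  ρ-high {c} m≤c = cong (λ b → if b then suc c else c)
    (¬true⇒false (c <ᵇ m) (λ e → ≤⇒≯ m≤c (<ᵇ⇒< c m (≡true⇒T e))))

  ρ<M : ∀ c → c < M → ρ c < M
  ρ<M c c<M with c <? m
  ... | yes c<m = subst (_< M) (sym (ρ-low c<m)) (≤-<-trans c<m m<M)
  ... | no c≮m = subst (_< M) (sym (ρ-high (≮⇒≥ c≮m))) c<M

  origin-cells : ∀ r j c → r < M → j < k → c < M →
    inJ0 k m r (j * M + c) ∨ inJ1 k m r (j * M + c) ≡ (r ≡ᵇ ρ c)
  origin-cells r j c r<M j<k c<M = bool-ext _ _ into onto
    where
    into : inJ0 k m r (j * M + c) ∨ inJ1 k m r (j * M + c) ≡ true → (r ≡ᵇ ρ c) ≡ true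
    into e with ∨-true⁻ _ _ e
    ... | inj₁ e0 = let (i , j′ , i<m , _ , r≡ , b≡) = J0⁻ r _ e0
                        c≡i = proj₂ (block-coords-injective M j c j′ i b≡ c<M (<-trans i<m m<M))
      in ≡ᵇ-complete (trans r≡ (trans (cong suc (sym c≡i)) (sym (ρ-low (subst (_< m) (sym c≡i) i<m)))))
    ... | inj₂ e1 = let (i , j′ , i<m , _ , r≡ , b≡) = J1⁻ r _ e1
                        c≡m+i = proj₂ (block-coords-injective M j c j′ (m + i) b≡ c<M (m+i<M i<m))
      in ≡ᵇ-complete (trans r≡ (trans (sym c≡m+i) (sym (ρ-high (subst (m ≤_) (sym c≡m+i) (m≤m+n m i))))))
    onto : (r ≡ᵇ ρ c) ≡ true → inJ0 k m r (j * M + c) ∨ inJ1 k m r (j * M + c) ≡ true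
    onto e with c <? m
    ... | yes c<m = ∨-trueˡ _ (subst (λ a → inJ0 k m a (j * M + c) ≡ true)
                      (sym (trans (≡ᵇ-sound r (ρ c) e) (ρ-low c<m))) (J0⁺ c j c<m j<k))
    ... | no c≮m = ∨-trueʳ _ (subst (λ a → inJ1 k m a (j * M + c) ≡ true)
                     (sym (trans (≡ᵇ-sound r (ρ c) e) (ρ-high m≤c)))
                     (subst (λ x → inJ1 k m x (j * M + x) ≡ true) m+[c∸m]≡c
                       (J1⁺ (c ∸ m) j c∸m<m j<k)))
      where
      m≤c : m ≤ c
      m≤c = ≮⇒≥ c≮m
      m+[c∸m]≡c : m + (c ∸ m) ≡ c
      m+[c∸m]≡c = m+[n∸m]≡n m≤c
      c∸m<m : c ∸ m < m
      c∸m<m = +-cancelˡ-< m (c ∸ m) m (subst₂ _<_ (sym m+[c∸m]≡c) M≡m+m c<M)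

  odd-cells : ∀ ℓ r j c → ℓ < t → r < M → j < k → c < M →
    inJ2 k m (suc (2 * ℓ) * M + r) (j * M + c) ≡ (c ≡ᵇ r)
  odd-cells ℓ r j c ℓ<t r<M j<k c<M = bool-ext _ _ into onto
    where
    into : inJ2 k m (suc (2 * ℓ) * M + r) (j * M + c) ≡ true → (c ≡ᵇ r) ≡ true
    into e = let (i , j′ , ℓ′ , i<M , _ , _ , a≡ , b≡) = J2⁻ (suc (2 * ℓ) * M + r) (j * M + c) e in
      ≡ᵇ-complete (trans (proj₂ (block-coords-injective M j c j′ i b≡ c<M i<M))
        (sym (proj₂ (block-coords-injective M (suc (2 * ℓ)) r (suc (2 * ℓ′)) i a≡ r<M i<M))))
    onto : (c ≡ᵇ r) ≡ true → inJ2 k m (suc (2 * ℓ) * M + r) (j * M + c) ≡ true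
    onto e = subst (λ y → inJ2 k m (suc (2 * ℓ) * M + r) (j * M + y) ≡ true)
      (sym (≡ᵇ-sound c r e)) (J2⁺ r j ℓ r<M j<k ℓ<t)

  J3-column-block : ∀ r j → r < M → j < k →
    Σ ℕ λ j′ → j′ < k × (j′ * M + suc r) mod n ≡ j * M + suc r % M
  J3-column-block r j r<M j<k with m≤n⇒m<n∨m≡n r<M
  ... | inj₁ r+1<M =
    j , j<k , trans (mod-n (in-range j<k r+1<M)) (cong (j * M +_) (sym (m<n⇒m%n≡m r+1<M)))
  ... | inj₂ r+1≡M = wrap j j<k
    where
    r+1%M≡0 : suc r % M ≡ 0
    r+1%M≡0 = trans (cong (_% M) r+1≡M) (n%n≡0 M)
    wrap : ∀ j → j < k → Σ ℕ λ j′ → j′ < k × (j′ * M + suc r) mod n ≡ j * M + suc r % M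
    wrap zero _ = 2 * t , ≤-refl , (begin
      (2 * t * M + suc r) mod n ≡⟨ cong (λ x → (2 * t * M + x) mod n) r+1≡M ⟩
      (2 * t * M + M) mod n     ≡⟨ cong (_mod n) (trans (+-comm (2 * t * M) M) (sym n≡k*M)) ⟩
      n mod n                   ≡⟨ n%n≡0 n ⟩
      0                         ≡⟨ sym r+1%M≡0 ⟩
      suc r % M                 ∎)
    wrap (suc j) j+1<k = j , <-trans (n<1+n j) j+1<k , (begin
      (j * M + suc r) mod n     ≡⟨ cong (λ x → (j * M + x) mod n) r+1≡M ⟩
      (j * M + M) mod n         ≡⟨ cong (_mod n) (trans (+-comm (j * M) M) (sym (+-identityʳ _))) ⟩
      (suc j * M + 0) mod n     ≡⟨ mod-n (in-range j+1<k (≤-<-trans z≤n m<M)) ⟩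
      suc j * M + 0             ≡⟨ cong (suc j * M +_) (sym r+1%M≡0) ⟩
      suc j * M + suc r % M     ∎)

  even-cells : ∀ ℓ r j c → ℓ < t → r < M → j < k → c < M →
    inJ3 k m (suc (suc (2 * ℓ)) * M + r) (j * M + c) ≡ (c ≡ᵇ suc r % M)
  even-cells ℓ r j c ℓ<t r<M j<k c<M = bool-ext _ _ into onto
    where
    into : inJ3 k m (suc (suc (2 * ℓ)) * M + r) (j * M + c) ≡ true → (c ≡ᵇ suc r % M) ≡ true
    into e = let (i , j′ , ℓ′ , i<M , _ , _ , a≡ , b≡) = J3⁻ (suc (suc (2 * ℓ)) * M + r) (j * M + c) e
                 r≡i = proj₂ (block-coords-injective M (suc (suc (2 * ℓ))) r (suc (suc (2 * ℓ′))) i a≡ r<M i<M)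
      in ≡ᵇ-complete (begin
        c                             ≡⟨ sym (m<n⇒m%n≡m c<M) ⟩
        c % M                         ≡⟨ sym (block-offset-mod M j c) ⟩
        (j * M + c) % M               ≡⟨ cong (_% M) b≡ ⟩
        (j′ * M + suc i) mod n % M    ≡⟨ m∣n⇒o%n%m≡o%m M n (j′ * M + suc i) (divides k n≡k*M) ⟩
        (j′ * M + suc i) % M          ≡⟨ block-offset-mod M j′ (suc i) ⟩
        suc i % M                     ≡⟨ cong (λ x → suc x % M) (sym r≡i) ⟩
        suc r % M                     ∎)
    onto : (c ≡ᵇ suc r % M) ≡ true → inJ3 k m (suc (suc (2 * ℓ)) * M + r) (j * M + c) ≡ true
    onto e = let (j′ , j′<k , column≡) = J3-column-block r j r<M j<k in
      subst (λ y → inJ3 k m (suc (suc (2 * ℓ)) * M + r) y ≡ true)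
        (trans column≡ (cong (j * M +_) (sym (≡ᵇ-sound c _ e)))) (J3⁺ r j′ ℓ r<M j′<k ℓ<t)

  origin-block : ∀ r j c → r < M → j < k → c < M → inJ k m r (j * M + c) ≡ (r ≡ᵇ ρ c)
  origin-block r j c r<M j<k c<M = begin
    inJ0 k m r b ∨ (inJ1 k m r b ∨ (inJ2 k m r b ∨ inJ3 k m r b))
      ≡⟨ cong (λ x → inJ0 k m r b ∨ (inJ1 k m r b ∨ x))
           (cong₂ _∨_ (J2-odd-only 0 r b r<M (λ _ ())) (J3-even-only 0 r b r<M (λ _ ()))) ⟩
    inJ0 k m r b ∨ (inJ1 k m r b ∨ false)
      ≡⟨ cong (inJ0 k m r b ∨_) (∨-identityʳ _) ⟩
    inJ0 k m r b ∨ inJ1 k m r b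
      ≡⟨ origin-cells r j c r<M j<k c<M ⟩
    r ≡ᵇ ρ c ∎
    where
    b = j * M + c

  odd-block : ∀ ℓ r j c → ℓ < t → r < M → j < k → c < M →
    inJ k m (suc (2 * ℓ) * M + r) (j * M + c) ≡ (c ≡ᵇ r)
  odd-block ℓ r j c ℓ<t r<M j<k c<M =
    trans (cong₂ _∨_ (J0-origin-only (2 * ℓ) r b r<M) (cong₂ _∨_ (J1-origin-only (2 * ℓ) r b r<M)
            (cong₂ _∨_ (odd-cells ℓ r j c ℓ<t r<M j<k c<M)
              (J3-even-only (suc (2 * ℓ)) r b r<M (odd≢even ℓ)))))
          (∨-identityʳ _)
    where
    b = j * M + c

  even-block : ∀ ℓ r j c → ℓ < t → r < M → j < k → c < M →
    inJ k m (suc (suc (2 * ℓ)) * M + r) (j * M + c) ≡ (c ≡ᵇ suc r % M)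
  even-block ℓ r j c ℓ<t r<M j<k c<M =
    cong₂ _∨_ (J0-origin-only (suc (2 * ℓ)) r b r<M) (cong₂ _∨_ (J1-origin-only (suc (2 * ℓ)) r b r<M)
      (cong₂ _∨_ (J2-odd-only (suc (suc (2 * ℓ))) r b r<M (λ ℓ′ e → odd≢even ℓ′ ℓ (sym e)))
        (even-cells ℓ r j c ℓ<t r<M j<k c<M)))
    where
    b = j * M + c

  column-blocks : ∀ (f : ℕ → ℕ) → sumN f n ≡ sumN (λ j → sumN (λ c → f (j * M + c)) M) k
  column-blocks f = trans (cong (sumN f) n≡k*M) (sumN-blocks k M f)

  count-by-row-blocks : ∀ (f : ℕ → ℕ) → sumN f M ≡ 1 →
    (∀ ℓ → ℓ < t → sumN (λ r → f (suc (2 * ℓ) * M + r)) M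
                 + sumN (λ r → f (suc (suc (2 * ℓ)) * M + r)) M ≡ 2) →
    sumN f n ≡ k
  count-by-row-blocks f origin pair = begin
    sumN f n                                 ≡⟨ cong (sumN f) n≡M+t[M+M] ⟩
    sumN f (M + t * (M + M))                 ≡⟨ sumN-origin-pairs t M f ⟩
    sumN f M + sumN _ t                      ≡⟨ cong₂ _+_ origin (sumN-ext t _ (λ _ → 2) pair) ⟩
    1 + sumN (λ _ → 2) t                     ≡⟨ cong suc (trans (sumN-const t 2) (*-comm t 2)) ⟩
    k                                        ∎
    where
    n≡M+t[M+M] : n ≡ M + t * (M + M)
    n≡M+t[M+M] = regroup t m
      where
      regroup : ∀ t m → 2 * suc (2 * t) * m ≡ 2 * m + t * (2 * m + 2 * m)
      regroup = solve-∀

  periodic-row : ∀ a (P : ℕ → Bool) → (∀ j c → j < k → c < M → inJ k m a (j * M + c) ≡ P c) →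
    rowCount k m a ≡ k * sumN (λ c → χ (P c)) M
  periodic-row a P membership = begin
    rowCount k m a
      ≡⟨ length-filter-applyUpTo (inJ k m a) (λ b → b) n ⟩
    sumN (λ b → χ (inJ k m a b)) n
      ≡⟨ column-blocks (λ b → χ (inJ k m a b)) ⟩
    sumN (λ j → sumN (λ c → χ (inJ k m a (j * M + c))) M) k
      ≡⟨ sumN-ext k _ _ (λ j j<k → sumN-ext M _ _ (λ c c<M → cong χ (membership j c j<k c<M))) ⟩
    sumN (λ _ → sumN (λ c → χ (P c)) M) k
      ≡⟨ sumN-const k _ ⟩
    k * sumN (λ c → χ (P c)) M ∎

  -- A row r of the origin block meets column c of each column block iff
  -- r = ρ c, i.e. c = r - 1 ∈ [0, m) or c = r ∈ [m, 2m).
  origin-row : ∀ r → r < M →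
    rowCount k m r ≡ k * (sumN (λ c → χ (r ≡ᵇ 1 + c)) m + sumN (λ c → χ (r ≡ᵇ m + c)) m)
  origin-row r r<M =
    trans (periodic-row r (λ c → r ≡ᵇ ρ c) (λ j c j<k c<M → origin-block r j c r<M j<k c<M))
          (cong (k *_) (trans (cong (sumN f) M≡m+m) (trans (sumN-+ m m f) (cong₂ _+_
            (sumN-ext m f _ (λ c c<m → cong (λ x → χ (r ≡ᵇ x)) (ρ-low c<m)))
            (sumN-ext m (λ c → f (m + c)) _ (λ c _ → cong (λ x → χ (r ≡ᵇ x)) (ρ-high (m≤m+n m c))))))))
    where
    f : ℕ → ℕ
    f c = χ (r ≡ᵇ ρ c)

  row-zero : rowCount k m 0 ≡ 0
  row-zero = trans (origin-row 0 (<-trans 0<m m<M)) (trans (cong₂ (λ x y → k * (x + y))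
    (window-miss 1 m 0 (inj₁ (s≤s z≤n))) (window-miss m m 0 (inj₁ 0<m))) (*-zeroʳ k))

  row-m : rowCount k m m ≡ 2 * k
  row-m = trans (origin-row m m<M) (trans (cong₂ (λ x y → k * (x + y))
    (window-hit 1 m m 0<m (n<1+n m)) (window-hit m m m ≤-refl (m<m+n m 0<m))) (*-comm k 2))

  origin-row-other : ∀ r → r < M → r ≢ 0 → r ≢ m → rowCount k m r ≡ k
  origin-row-other r r<M r≢0 r≢m with <-cmp r m
  ... | tri< r<m _ _ = trans (origin-row r r<M) (trans (cong₂ (λ x y → k * (x + y))
          (window-hit 1 m r (n≢0⇒n>0 r≢0) (<-trans r<m (n<1+n m))) (window-miss m m r (inj₁ r<m)))
          (*-identityʳ k))
  ... | tri≈ _ r≡m _ = ⊥-elim (r≢m r≡m)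
  ... | tri> _ _ m<r = trans (origin-row r r<M) (trans (cong₂ (λ x y → k * (x + y))
          (window-miss 1 m r (inj₂ m<r)) (window-hit m m r (<⇒≤ m<r) (subst (r <_) M≡m+m r<M)))
          (*-identityʳ k))

  data RowBlock (q : ℕ) : Set where
    origin-block-row : q ≡ 0 → RowBlock q
    odd-block-row : ∀ ℓ → ℓ < t → q ≡ suc (2 * ℓ) → RowBlock q
    even-block-row : ∀ ℓ → ℓ < t → q ≡ suc (suc (2 * ℓ)) → RowBlock q

  row-block : ∀ q → q < k → RowBlock q
  row-block q q<k with parity q
  ... | inj₂ (ℓ , q≡) = odd-block-row ℓ (*-cancelˡ-< 2 ℓ t (s≤s⁻¹ (subst (_< k) q≡ q<k))) q≡
  ... | inj₁ (zero , q≡) = origin-block-row q≡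
  ... | inj₁ (suc ℓ , q≡) = even-block-row ℓ (*-cancelˡ-< 2 ℓ t (<-trans (n<1+n _) (s≤s⁻¹ (subst (_< k) q≡′ q<k)))) q≡′
    where
    q≡′ : q ≡ suc (suc (2 * ℓ))
    q≡′ = trans q≡ (*-suc 2 ℓ)

  block-coords-of : ∀ x {q} → x / M ≡ q → x ≡ q * M + x % M
  block-coords-of x refl = block-coords M x

  -- Every row other than 0 and m contains k cells of J: in the odd and even
  -- blocks the pattern row has exactly one cell.
  row-other : ∀ x → x < n → x ≢ 0 → x ≢ m → rowCount k m x ≡ k
  row-other x x<n x≢0 x≢m with row-block (x / M) (block<k x<n)
  ... | origin-block-row q≡0 = origin-row-other x (subst (_< M) (sym (block-coords-of x q≡0)) r<M) x≢0 x≢m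
    where
    r<M = m%n<n x M
  ... | odd-block-row ℓ ℓ<t q≡ = begin
    rowCount k m x                               ≡⟨ cong (rowCount k m) (block-coords-of x q≡) ⟩
    rowCount k m (suc (2 * ℓ) * M + r)           ≡⟨ periodic-row (suc (2 * ℓ) * M + r) (λ c → c ≡ᵇ r)
                                                      (λ j c j<k c<M → odd-block ℓ r j c ℓ<t r<M j<k c<M) ⟩
    k * sumN (λ c → χ (c ≡ᵇ r)) M                ≡⟨ cong (k *_) (sum-δ₁ M r r<M) ⟩
    k * 1                                        ≡⟨ *-identityʳ k ⟩
    k                                            ∎
    where
    r = x % M
    r<M = m%n<n x M
  ... | even-block-row ℓ ℓ<t q≡ = begin
    rowCount k m x                               ≡⟨ cong (rowCount k m) (block-coords-of x q≡) ⟩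
    rowCount k m (suc (suc (2 * ℓ)) * M + r)     ≡⟨ periodic-row (suc (suc (2 * ℓ)) * M + r) (λ c → c ≡ᵇ suc r % M)
                                                      (λ j c j<k c<M → even-block ℓ r j c ℓ<t r<M j<k c<M) ⟩
    k * sumN (λ c → χ (c ≡ᵇ suc r % M)) M        ≡⟨ cong (k *_) (sum-δ₁ M (suc r % M) (m%n<n (suc r) M)) ⟩
    k * 1                                        ≡⟨ *-identityʳ k ⟩
    k                                            ∎
    where
    r = x % M
    r<M = m%n<n x M

  -- Column c of a block meets the even row blocks in row (c - 1) mod M: the
  -- map r ↦ (r + 1) mod M is a bijection of N_M.
  cyclic-successor-preimages : ∀ c → c < M → sumN (λ r → χ (c ≡ᵇ suc r % M)) M ≡ 1
  cyclic-successor-preimages c c<M = begin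
    sumN (λ r → χ (c ≡ᵇ suc r % M)) M
      ≡⟨ sumN-last (pred M) (λ r → χ (c ≡ᵇ suc r % M)) ⟩
    sumN (λ r → χ (c ≡ᵇ suc r % M)) (pred M) + χ (c ≡ᵇ M % M)
      ≡⟨ cong₂ _+_ (sumN-ext (pred M) _ _ (λ r r<M-1 → cong (λ x → χ (c ≡ᵇ x)) (m<n⇒m%n≡m (s≤s r<M-1))))
                   (cong (λ x → χ (c ≡ᵇ x)) (n%n≡0 M)) ⟩
    sumN (λ r → χ (c ≡ᵇ 1 + r)) (pred M) + χ (c ≡ᵇ 0)
      ≡⟨ wrap c c<M ⟩
    1 ∎
    where
    wrap : ∀ c → c < M → sumN (λ r → χ (c ≡ᵇ 1 + r)) (pred M) + χ (c ≡ᵇ 0) ≡ 1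
    wrap zero _ = cong (_+ 1) (window-miss 1 (pred M) 0 (inj₁ (s≤s z≤n)))
    wrap (suc c) c<M = cong (_+ 0) (window-hit 1 (pred M) (suc c) (s≤s z≤n) c<M)

  -- Column c of a block meets the origin row block in row ρ c, an odd block in
  -- row c and an even block in row (c - 1) mod M.
  column-count : ∀ x → x < n → colCount k m x ≡ k
  column-count x x<n = begin
    colCount k m x
      ≡⟨ cong (colCount k m) (block-coords M x) ⟩
    colCount k m (j * M + c)
      ≡⟨ length-filter-applyUpTo (λ a → inJ k m a (j * M + c)) (λ a → a) n ⟩
    sumN (λ a → χ (inJ k m a (j * M + c))) n
      ≡⟨ count-by-row-blocks (λ a → χ (inJ k m a (j * M + c))) origin pair ⟩
    k ∎
    where
    j = x / M
    c = x % M
    j<k = block<k x<n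
    c<M = m%n<n x M
    origin : sumN (λ r → χ (inJ k m r (j * M + c))) M ≡ 1
    origin = trans (sumN-ext M _ _ (λ r r<M → cong χ (origin-block r j c r<M j<k c<M)))
                   (sum-δ₁ M (ρ c) (ρ<M c c<M))
    pair : ∀ ℓ → ℓ < t → sumN (λ r → χ (inJ k m (suc (2 * ℓ) * M + r) (j * M + c))) M
                       + sumN (λ r → χ (inJ k m (suc (suc (2 * ℓ)) * M + r) (j * M + c))) M ≡ 2
    pair ℓ ℓ<t = cong₂ _+_
      (trans (sumN-ext M _ _ (λ r r<M → cong χ (trans (odd-block ℓ r j c ℓ<t r<M j<k c<M) (≡ᵇ-comm c r))))
             (sum-δ₁ M c c<M))
      (trans (sumN-ext M _ _ (λ r r<M → cong χ (even-block ℓ r j c ℓ<t r<M j<k c<M)))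
             (cyclic-successor-preimages c c<M))

  module Symbols (s : ℕ) (s<n : s < n) where
    s′ : ℕ
    s′ = s % M

    -- fibre x counts the j < k with (x + jM) mod n = s: the k translates of x
    -- by multiples of M cover the residue class of x mod M exactly once.
    fibre : ℕ → ℕ
    fibre x = sumN (λ j → χ (s ≡ᵇ (x + j * M) mod n)) k

    fibre-periodic : ∀ x → fibre (x + M) ≡ fibre x
    fibre-periodic x = begin
      fibre (x + M)
        ≡⟨ sumN-ext k _ (λ j → χ (s ≡ᵇ (x + suc j * M) mod n))
             (λ j _ → cong (λ z → χ (s ≡ᵇ z mod n)) (+-assoc x M (j * M))) ⟩
      sumN (λ j → χ (s ≡ᵇ (x + suc j * M) mod n)) k
        ≡⟨ sumN-rotate k (λ j → χ (s ≡ᵇ (x + j * M) mod n)) (cong (λ z → χ (s ≡ᵇ z)) x+n≡x) ⟩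
      fibre x ∎
      where
      x+n≡x : (x + k * M) mod n ≡ (x + 0 * M) mod n
      x+n≡x = trans (cong (λ z → (x + z) mod n) (sym n≡k*M))
                    (trans ([m+n]%n≡m%n x n) (cong (_mod n) (sym (+-identityʳ x))))

    fibre-shift : ∀ d x → fibre (x + d * M) ≡ fibre x
    fibre-shift zero x = cong fibre (+-identityʳ x)
    fibre-shift (suc d) x =
      trans (cong fibre (regroup x M (d * M))) (trans (fibre-periodic (x + d * M)) (fibre-shift d x))
      where
      regroup : ∀ x M D → x + (M + D) ≡ x + D + M
      regroup = solve-∀

    fibre-small : ∀ y → y < M → fibre y ≡ χ (s′ ≡ᵇ y)
    fibre-small y y<M = begin
      fibre y
        ≡⟨ sumN-ext k _ (λ j → χ (s ≡ᵇ y + j * M))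
             (λ j j<k → cong (λ z → χ (s ≡ᵇ z)) (mod-n (subst (_< n) (+-comm (j * M) y) (in-range j<k y<M)))) ⟩
      sumN (λ j → χ (s ≡ᵇ y + j * M)) k
        ≡⟨ sumN-single k q (λ j → χ (s ≡ᵇ y + j * M)) (block<k s<n)
             (λ j _ j≢q → cong χ (≡ᵇ-false s _ (λ s≡ → j≢q (proj₁ (same-coords j s≡))))) ⟩
      χ (s ≡ᵇ y + q * M)
        ≡⟨ cong χ (bool-ext _ _
             (λ e → ≡ᵇ-complete (sym (proj₂ (same-coords q (≡ᵇ-sound s _ e)))))
             (λ e → ≡ᵇ-complete (trans s≡ (trans (cong (q * M +_) (≡ᵇ-sound s′ y e)) (+-comm (q * M) y))))) ⟩
      χ (s′ ≡ᵇ y) ∎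
      where
      q = s / M
      s≡ : s ≡ q * M + s′
      s≡ = block-coords M s
      same-coords : ∀ j → s ≡ y + j * M → j ≡ q × y ≡ s′
      same-coords j s≡′ = block-coords-injective M j y q s′
        (trans (+-comm (j * M) y) (trans (sym s≡′) s≡)) y<M (m%n<n s M)

    symbol-fibre : ∀ x → fibre x ≡ χ (s′ ≡ᵇ x % M)
    symbol-fibre x =
      trans (cong fibre (m≡m%n+[m/n]*n x M))
            (trans (fibre-shift (x / M) (x % M)) (fibre-small (x % M) (m%n<n x M)))

    symbol-test : ℕ → ℕ → Bool
    symbol-test a b = inJ k m a b ∧ (s ≡ᵇ (a + b) mod n)

    symbols-by-rows : symCount k m s ≡ sumN (λ a → sumN (λ b → χ (symbol-test a b)) n) n
    symbols-by-rows =
      trans (length-filter-concat test (λ a → map (a ,_) (upTo n)) (λ a → a) n)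
        (sumN-ext n _ _ (λ a _ → trans (length-filter-pairs test a (upTo n))
                                       (length-filter-applyUpTo (symbol-test a) (λ b → b) n)))
      where
      test : ℕ × ℕ → Bool
      test (a , b) = symbol-test a b

    row-symbols : ℕ → ℕ
    row-symbols a = sumN (λ b → χ (symbol-test a b)) n

    periodic-row-symbols : ∀ a (P : ℕ → Bool) →
      (∀ j c → j < k → c < M → inJ k m a (j * M + c) ≡ P c) →
      row-symbols a ≡ sumN (λ c → χ (P c ∧ (s′ ≡ᵇ (a + c) % M))) M
    periodic-row-symbols a P membership = begin
      row-symbols a
        ≡⟨ column-blocks (λ b → χ (symbol-test a b)) ⟩
      sumN (λ j → sumN (λ c → χ (symbol-test a (j * M + c))) M) k
        ≡⟨ sumN-ext k _ (λ j → sumN (G j) M) (λ j j<k → sumN-ext M _ (G j)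
             (λ c c<M → cong (λ p → χ (p ∧ (s ≡ᵇ (a + (j * M + c)) mod n))) (membership j c j<k c<M))) ⟩
      sumN (λ j → sumN (G j) M) k
        ≡⟨ sumN-swap k M G ⟩
      sumN (λ c → sumN (λ j → G j c) k) M
        ≡⟨ sumN-ext M _ _ (λ c _ → sum-χ-∧ k (P c) (λ j → s ≡ᵇ (a + (j * M + c)) mod n) (s′ ≡ᵇ (a + c) % M)
             (trans (sumN-ext k _ _ (λ j _ → cong (λ z → χ (s ≡ᵇ z mod n)) (regroup a (j * M) c)))
                    (symbol-fibre (a + c)))) ⟩
      sumN (λ c → χ (P c ∧ (s′ ≡ᵇ (a + c) % M))) M ∎
      where
      G : ℕ → ℕ → ℕ
      G j c = χ (P c ∧ (s ≡ᵇ (a + (j * M + c)) mod n))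
      regroup : ∀ a x c → a + (x + c) ≡ a + c + x
      regroup = solve-∀

    δ : ℕ → ℕ
    δ x = χ (s′ ≡ᵇ x)

    δ-total : sumN δ M ≡ 1
    δ-total = trans (sumN-ext M _ _ (λ x _ → cong χ (≡ᵇ-comm s′ x))) (sum-δ₁ M s′ (m%n<n s M))

    δ-pairs : sumN (λ r → δ (r + r) + δ (suc (r + r))) m ≡ 1
    δ-pairs = trans (sym (sumN-pairs m δ)) (trans (cong (sumN δ) (sym M≡m+m)) δ-total)

    r+r<M : ∀ {r} → r < m → r + r < M
    r+r<M {r} r<m = subst (r + r <_) (sym M≡m+m) (+-mono-< r<m r<m)

    1+r+r<M : ∀ {r} → r < m → suc (r + r) < M
    1+r+r<M {r} r<m = subst (suc (r + r) <_) (sym M≡m+m) (≤-<-trans (+-monoˡ-≤ r r<m) (+-monoʳ-< m r<m))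

    half-shift : ∀ x y → (m + x + (m + y)) % M ≡ (x + y) % M
    half-shift x y = trans (cong (_% M) (regroup m x y)) ([m+n]%n≡m%n (x + y) M)
      where
      regroup : ∀ m x y → m + x + (m + y) ≡ x + y + 2 * m
      regroup = solve-∀

    -- The origin row block contains each symbol of the residue class s′ once:
    -- column c carries symbol 2c + 1 (c < m) or 2c - 2m (c ≥ m) modulo M.
    origin-symbols : sumN row-symbols M ≡ 1
    origin-symbols = begin
      sumN row-symbols M
        ≡⟨ sumN-ext M _ (λ r → sumN (S r) M) (λ r r<M → periodic-row-symbols r (λ c → r ≡ᵇ ρ c)
             (λ j c j<k c<M → origin-block r j c r<M j<k c<M)) ⟩
      sumN (λ r → sumN (S r) M) M
        ≡⟨ sumN-swap M M S ⟩
      sumN (λ c → sumN (λ r → S r c) M) M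
        ≡⟨ sumN-ext M _ _ (λ c c<M → sum-δ M (ρ c) (λ r → s′ ≡ᵇ (r + c) % M) (ρ<M c c<M)) ⟩
      sumN ρ-symbol M
        ≡⟨ trans (cong (sumN ρ-symbol) M≡m+m) (sumN-+ m m ρ-symbol) ⟩
      sumN ρ-symbol m + sumN (λ c → ρ-symbol (m + c)) m
        ≡⟨ cong₂ _+_ (sumN-ext m _ _ low) (sumN-ext m _ _ high) ⟩
      sumN (λ c → δ (suc (c + c))) m + sumN (λ c → δ (c + c)) m
        ≡⟨ +-comm (sumN (λ c → δ (suc (c + c))) m) (sumN (λ c → δ (c + c)) m) ⟩
      sumN (λ c → δ (c + c)) m + sumN (λ c → δ (suc (c + c))) m
        ≡⟨ sym (sumN-distrib m (λ c → δ (c + c)) (λ c → δ (suc (c + c)))) ⟩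
      sumN (λ c → δ (c + c) + δ (suc (c + c))) m
        ≡⟨ δ-pairs ⟩
      1 ∎
      where
      S : ℕ → ℕ → ℕ
      S r c = χ ((r ≡ᵇ ρ c) ∧ (s′ ≡ᵇ (r + c) % M))
      ρ-symbol : ℕ → ℕ
      ρ-symbol c = δ ((ρ c + c) % M)
      low : ∀ c → c < m → ρ-symbol c ≡ δ (suc (c + c))
      low c c<m = cong δ (trans (cong (λ y → (y + c) % M) (ρ-low c<m)) (m<n⇒m%n≡m (1+r+r<M c<m)))
      high : ∀ c → c < m → ρ-symbol (m + c) ≡ δ (c + c)
      high c c<m = cong δ (trans (cong (λ y → (y + (m + c)) % M) (ρ-high (m≤m+n m c)))
                                 (trans (half-shift c c) (m<n⇒m%n≡m (r+r<M c<m))))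

    odd-row-symbols : ∀ ℓ r → ℓ < t → r < M → row-symbols (suc (2 * ℓ) * M + r) ≡ δ ((r + r) % M)
    odd-row-symbols ℓ r ℓ<t r<M =
      trans (periodic-row-symbols a (λ c → c ≡ᵇ r) (λ j c j<k c<M → odd-block ℓ r j c ℓ<t r<M j<k c<M))
        (trans (sum-δ M r (λ c → s′ ≡ᵇ (a + c) % M) r<M)
          (cong δ (trans (cong (_% M) (+-assoc (suc (2 * ℓ) * M) r r)) (block-offset-mod M (suc (2 * ℓ)) (r + r)))))
      where
      a = suc (2 * ℓ) * M + r

    even-row-symbols : ∀ ℓ r → ℓ < t → r < M →
      row-symbols (suc (suc (2 * ℓ)) * M + r) ≡ δ ((r + suc r) % M)
    even-row-symbols ℓ r ℓ<t r<M =
      trans (periodic-row-symbols a (λ c → c ≡ᵇ suc r % M) (λ j c j<k c<M → even-block ℓ r j c ℓ<t r<M j<k c<M))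
        (trans (sum-δ M (suc r % M) (λ c → s′ ≡ᵇ (a + c) % M) (m%n<n (suc r) M))
          (cong δ (trans (cong (_% M) (+-assoc (suc (suc (2 * ℓ)) * M) r (suc r % M)))
            (trans (block-offset-mod M (suc (suc (2 * ℓ))) (r + suc r % M)) (mod-summand M r (suc r))))))
      where
      a = suc (suc (2 * ℓ)) * M + r

    -- An odd and an even row block together carry each symbol of the residue
    -- class s′ twice: as r runs over N_M, 2r and 2r + 1 cover N_M twice mod M.
    pair-symbols : ∀ ℓ → ℓ < t →
      sumN (λ r → row-symbols (suc (2 * ℓ) * M + r)) M
        + sumN (λ r → row-symbols (suc (suc (2 * ℓ)) * M + r)) M ≡ 2
    pair-symbols ℓ ℓ<t = begin
      sumN (λ r → row-symbols (suc (2 * ℓ) * M + r)) M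
        + sumN (λ r → row-symbols (suc (suc (2 * ℓ)) * M + r)) M
        ≡⟨ cong₂ _+_ (sumN-ext M _ _ (λ r r<M → odd-row-symbols ℓ r ℓ<t r<M))
                     (sumN-ext M _ _ (λ r r<M → even-row-symbols ℓ r ℓ<t r<M)) ⟩
      sumN (λ r → δ ((r + r) % M)) M + sumN (λ r → δ ((r + suc r) % M)) M
        ≡⟨ sym (sumN-distrib M (λ r → δ ((r + r) % M)) (λ r → δ ((r + suc r) % M))) ⟩
      sumN h M
        ≡⟨ trans (cong (sumN h) M≡m+m) (sumN-+ m m h) ⟩
      sumN h m + sumN (λ r → h (m + r)) m
        ≡⟨ cong₂ _+_ (sumN-ext m _ _ h-low) (sumN-ext m _ _ (λ r r<m → trans (h-periodic r) (h-low r r<m))) ⟩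
      sumN (λ r → δ (r + r) + δ (suc (r + r))) m + sumN (λ r → δ (r + r) + δ (suc (r + r))) m
        ≡⟨ cong₂ _+_ δ-pairs δ-pairs ⟩
      2 ∎
      where
      h : ℕ → ℕ
      h r = δ ((r + r) % M) + δ ((r + suc r) % M)
      h-low : ∀ r → r < m → h r ≡ δ (r + r) + δ (suc (r + r))
      h-low r r<m = cong₂ (λ x y → δ x + δ y) (m<n⇒m%n≡m (r+r<M r<m))
        (trans (cong (_% M) (+-suc r r)) (m<n⇒m%n≡m (1+r+r<M r<m)))
      h-periodic : ∀ r → h (m + r) ≡ h r
      h-periodic r = cong₂ (λ x y → δ x + δ y) (half-shift r r)
        (trans (cong (λ z → (m + r + z) % M) (sym (+-suc m r))) (half-shift r (suc r)))

    symbol-count : symCount k m s ≡ k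
    symbol-count = trans symbols-by-rows (count-by-row-blocks row-symbols origin-symbols pair-symbols)

lemma3p1 : (k m : ℕ) → (∃[ t ] k ≡ suc (2 * t)) → 2 ≤ m →
    ((c : ℕ) → c < 2 * k * m → colCount k m c ≡ k) ×
    ((s : ℕ) → s < 2 * k * m → symCount k m s ≡ k) ×
    ((r : ℕ) → r < 2 * k * m → r ≢ 0 → r ≢ m → rowCount k m r ≡ k) ×
    rowCount k m 0 ≡ 0 ×
    rowCount k m m ≡ 2 * k
lemma3p1 .(suc (2 * t)) (suc (suc m')) (t , refl) (s≤s (s≤s z≤n)) =
  column-count , (λ s s<n → Symbols.symbol-count s s<n) , row-other , row-zero , row-m
  where
  open Layout t m'
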